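{- Let $n \ge 1$, let $\pi$ and $\tau$ be permutations of $\{1, \ldots, n^2\}$ and let $x = (x_1, \ldots, x_{n^2})^T \in \mathbb{Z}^{n^2}$ with $1 \le x_i \le n$ for $i = 1, \ldots, n^2$. Consider the statements: (i) $A_\pi x <> \mathbf{0}$; (ii) $A_\pi \tau(x) <> \mathbf{0}$; (iii) $\tau$ is $\pi$-$x$-consistent. Any two of these statements imply the third.
   Context: For $y \in \mathbb{Z}^s$ write $y <> \mathbf{0}$ if every component of $y$ is nonzero. Let $s(n) = \sum_{i=1}^{n-1} i$. The $s(n) \times n$ matrix $A(n)$ is defined inductively: $A(1)$ is the empty matrix, and $A(n) = \begin{pmatrix} \mathbf{1}_{n-1} & -U_{n-1} \\ \mathbf{0}_{s(n-1)} & A(n-1) \end{pmatrix}$, where $\mathbf{1}_{n-1}$ is the all-ones column, $U_{n-1}$ the identity matrix and $\mathbf{0}_{s(n-1)}$ the zero column of length $s(n-1)$. Let $A$ be the $(n \cdot s(n)) \times n^2$ block-diagonal matrix whose $n$ diagonal blocks all equal $A(n)$. For a permutation $\pi$ of $\{1,\ldots,n^2\}$, $A_\pi$ is the matrix whose $j$-th column is the $\pi^{ -1}(j)$-th column of $A$. For a permutation $\tau$ and $x \in \mathbb{Z}^{n^2}$, $\tau(x) = (x_{\tau^{ -1}(1)}, \ldots, x_{\tau^{ -1}(n^2)})^T$. The constraint sets of $\pi$ are $cs_\pi(j) = \{\pi(i) \mid (j-1)n + 1 \le i \le jn\}$, $j=1,\ldots,n$. A permutation $\tau$ is called $\pi$-$x$-consistent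 if $\{x_{\tau^{ -1}(i)} \mid i \in cs_\pi(j)\} = \{x_i \mid i \in cs_\pi(j)\}$ for $j = 1, \ldots, n$. -}

module Defs where

open import Data.Nat using (ℕ; zero; suc)
import Data.Nat as ℕ
open import Data.Integer using (ℤ; +_; -_; _+_; _*_; _≤_; 0ℤ; 1ℤ)
open import Data.Fin using (Fin; zero; suc; splitAt; remQuot; combine; _≟_)
open import Data.Fin.Permutation using (Permutation′; _⟨$⟩ʳ_; _⟨$⟩ˡ_)
open import Data.Sum using (inj₁; inj₂)
open import Data.Product using (_×_; _,_; ∃; ∃-syntax)
open import Relation.Nullary using (¬_; yes; no)
open import Relation.Binary.PropositionalEquality using (_≡_)
open import Function.Bundles using (_⇔_)

-- s(n) = 1 + 2 + ... + (n-1);  s (suc n) = n + s n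
s : ℕ → ℕ
s zero    = zero
s (suc n) = n ℕ.+ s n

-- matrices as functions of (0-based) row and column indices
Matrix : ℕ → ℕ → Set
Matrix m k = Fin m → Fin k → ℤ

-- A(n) as defined inductively in the paper:
-- A(n+1) = [ 1_n  -U_n ; 0_{s(n)}  A(n) ]   (rows: first n, then s(n))
-- A(0), A(1) are empty (no rows).
Amat : (n : ℕ) → Matrix (s n) n
Amat (suc n) r c with splitAt n r | c
... | inj₁ i | zero  = 1ℤ
... | inj₁ i | suc j with i ≟ j
...   | yes _ = - 1ℤ
...   | no  _ = 0ℤ
Amat (suc n) r c | inj₂ k | zero  = 0ℤ
Amat (suc n) r c | inj₂ k | suc j = Amat n k j

-- block-diagonal matrix with n diagonal blocks, each equal to A(n);
-- row index = b * s(n) + r', column index = b' * n + c'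
Ablock : (n : ℕ) → Matrix (n ℕ.* s n) (n ℕ.* n)
Ablock n r c with remQuot {n} (s n) r | remQuot {n} n c
... | (b , r') | (b' , c') with b ≟ b'
...   | yes _ = Amat n r' c'
...   | no  _ = 0ℤ

Aπ : (n : ℕ) → Permutation′ (n ℕ.* n) → Matrix (n ℕ.* s n) (n ℕ.* n)
Aπ n π r j = Ablock n r (π ⟨$⟩ˡ j)

sumFin : (m : ℕ) → (Fin m → ℤ) → ℤ
sumFin zero    f = 0ℤ
sumFin (suc m) f = f zero + sumFin m (λ i → f (suc i))

_·_ : ∀ {m k} → Matrix m k → (Fin k → ℤ) → (Fin m → ℤ)
_·_ {m} {k} M x r = sumFin k (λ j → M r j * x j)

AllNonzero : ∀ {m} → (Fin m → ℤ) → Set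
AllNonzero y = ∀ r → ¬ (y r ≡ 0ℤ)

permVec : ∀ {N} → Permutation′ N → (Fin N → ℤ) → (Fin N → ℤ)
permVec τ x i = x (τ ⟨$⟩ˡ i)

-- membership in the constraint set cs_π(j) = { π(i) | i in block j }
-- (0-based: block j consists of the indices j * n + k, k < n)
InCS : (n : ℕ) → Permutation′ (n ℕ.* n) → Fin n → Fin (n ℕ.* n) → Set
InCS n π j i = ∃[ k ] (π ⟨$⟩ʳ combine {n} {n} j k ≡ i)

-- τ is π-x-consistent:
-- { x_{τ⁻¹(i)} | i ∈ cs_π(j) } = { x_i | i ∈ cs_π(j) } for all j
Consistent : (n : ℕ) → Permutation′ (n ℕ.* n) → (Fin (n ℕ.* n) → ℤ) → Permutation′ (n ℕ.* n) → Set
Consistent n π x τ = ∀ (j : Fin n) (v : ℤ) →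
  (∃[ i ] (InCS n π j i × x (τ ⟨$⟩ˡ i) ≡ v)) ⇔ (∃[ i ] (InCS n π j i × x i ≡ v))

-- Every row of A(n) has exactly one entry +1 (column a) and one
-- entry −1 (column b ≠ a), and every pair of distinct columns occurs in some
-- row.  Hence a row of A_π, taken in block β, evaluates on y to the difference
-- y_p − y_q of two entries of the constraint set cs_π(β), and every such
-- difference occurs.  So A_π y <> 0 iff y is injective on every constraint set.
-- For a vector with entries in {1,…,n}, injectivity on a set of n positions is
-- the same as taking every value 1,…,n there (pigeonhole).  Consistency says that
-- x and τ(x) take the same values on each constraint set, and the theorem
-- follows: (i),(ii) both say "all values occur", which forces equal value sets;
-- and (iii) transports "all values occur" between x and τ(x).
module Submission where

open import Defs
open import Data.Nat using (ℕ; zero; suc; _≥_; z≤n; s≤s)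
import Data.Nat as ℕ
import Data.Nat.Properties as ℕ
open import Data.Integer using (ℤ; +_; -_; _+_; _-_; _*_; _≤_; +≤+; 0ℤ; 1ℤ)
open import Data.Integer.Properties
  using (+-identityˡ; +-identityʳ; +-comm; *-identityˡ; *-zeroˡ; +-injective; -1*i≡-i; i≡j⇒i-j≡0; i-j≡0⇒i≡j)
open import Data.Fin using (Fin; zero; suc; splitAt; combine; quotRem; toℕ; fromℕ<; punchOut; _≟_; _↑ˡ_; _↑ʳ_)
open import Data.Fin.Properties
  using ( suc-injective; toℕ-injective; toℕ<n; toℕ-fromℕ<; splitAt-↑ˡ; splitAt-↑ʳ
        ; splitAt⁻¹-↑ˡ; splitAt⁻¹-↑ʳ; remQuot-combine; combine-surjective; combine-injectiveʳ
        ; any?; punchOut-injective; injective⇒≤)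
open import Data.Fin.Permutation using (Permutation′; _⟨$⟩ʳ_; _⟨$⟩ˡ_; inverseˡ; inverseʳ)
open import Data.Sum using (inj₁; inj₂; _⊎_)
open import Data.Product using (_×_; _,_; swap; ∃; ∃₂; ∃-syntax; proj₁; proj₂)
open import Function using (_∘_)
open import Function.Bundles using (_⇔_; mk⇔; Equivalence)
open import Function.Construct.Composition using (_⇔-∘_)
open import Function.Construct.Symmetry using (⇔-sym)
open import Relation.Nullary using (yes; no; contradiction)
open import Relation.Binary.PropositionalEquality

IsEdge : ∀ n → Fin (s n) → Fin n → Fin n → Set
IsEdge n r a b =
  Amat n r a ≡ 1ℤ × Amat n r b ≡ - 1ℤ × (∀ c → c ≢ a → c ≢ b → Amat n r c ≡ 0ℤ)

edge-distinct : ∀ {n r a b} → IsEdge n r a b → a ≢ b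
edge-distinct (a↦1 , b↦-1 , _) refl with trans (sym a↦1) b↦-1
... | ()

top-edge : ∀ n (i : Fin n) → IsEdge (suc n) (i ↑ˡ s n) zero (suc i)
top-edge n i = first , diagonal , elsewhere
  where
  first : Amat (suc n) (i ↑ˡ s n) zero ≡ 1ℤ
  first rewrite splitAt-↑ˡ n i (s n) = refl
  diagonal : Amat (suc n) (i ↑ˡ s n) (suc i) ≡ - 1ℤ
  diagonal rewrite splitAt-↑ˡ n i (s n) with i ≟ i
  ... | yes _   = refl
  ... | no  i≢i = contradiction refl i≢i
  elsewhere : ∀ c → c ≢ zero → c ≢ suc i → Amat (suc n) (i ↑ˡ s n) c ≡ 0ℤ
  elsewhere zero    c≢0 _ = contradiction refl c≢0
  elsewhere (suc j) _ c≢i rewrite splitAt-↑ˡ n i (s n) with i ≟ j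
  ... | yes refl = contradiction refl c≢i
  ... | no  _    = refl

bottom-edge : ∀ n (r : Fin (s n)) {a b} → IsEdge n r a b → IsEdge (suc n) (n ↑ʳ r) (suc a) (suc b)
bottom-edge n r (a↦1 , b↦-1 , rest) = first , second , elsewhere
  where
  first : Amat (suc n) (n ↑ʳ r) (suc _) ≡ 1ℤ
  first rewrite splitAt-↑ʳ n (s n) r = a↦1
  second : Amat (suc n) (n ↑ʳ r) (suc _) ≡ - 1ℤ
  second rewrite splitAt-↑ʳ n (s n) r = b↦-1
  elsewhere : ∀ c → c ≢ suc _ → c ≢ suc _ → Amat (suc n) (n ↑ʳ r) c ≡ 0ℤ
  elsewhere zero    _    _    rewrite splitAt-↑ʳ n (s n) r = refl
  elsewhere (suc c) c≢a c≢b rewrite splitAt-↑ʳ n (s n) r =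
    rest c (c≢a ∘ cong suc) (c≢b ∘ cong suc)

row-is-edge : ∀ n (r : Fin (s n)) → ∃₂ λ a b → IsEdge n r a b
row-is-edge (suc n) r = by-block (splitAt n r) refl
  where
  by-block : ∀ half → splitAt n r ≡ half → ∃₂ λ a b → IsEdge (suc n) r a b
  by-block (inj₁ i) eq =
    zero , suc i , subst (λ r → IsEdge (suc n) r zero (suc i)) (splitAt⁻¹-↑ˡ eq) (top-edge n i)
  by-block (inj₂ k) eq with a , b , edge ← row-is-edge n k =
    suc a , suc b , subst (λ r → IsEdge (suc n) r (suc a) (suc b)) (splitAt⁻¹-↑ʳ {n} {s n} eq) (bottom-edge n k edge)

edge-is-row : ∀ n (a b : Fin n) → a ≢ b → ∃ λ r → IsEdge n r a b ⊎ IsEdge n r b a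
edge-is-row (suc n) zero    zero    a≢b = contradiction refl a≢b
edge-is-row (suc n) zero    (suc j) _   = j ↑ˡ s n , inj₁ (top-edge n j)
edge-is-row (suc n) (suc j) zero    _   = j ↑ˡ s n , inj₂ (top-edge n j)
edge-is-row (suc n) (suc a) (suc b) a≢b with edge-is-row n a b (a≢b ∘ cong suc)
... | r , inj₁ edge = n ↑ʳ r , inj₁ (bottom-edge n r edge)
... | r , inj₂ edge = n ↑ʳ r , inj₂ (bottom-edge n r edge)

sumFin-zero : ∀ m (f : Fin m → ℤ) → (∀ j → f j ≡ 0ℤ) → sumFin m f ≡ 0ℤ
sumFin-zero zero    f f≡0 = refl
sumFin-zero (suc m) f f≡0 rewrite f≡0 zero = trans (+-identityˡ _) (sumFin-zero m (f ∘ suc) (f≡0 ∘ suc))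

sumFin-single : ∀ m (f : Fin m → ℤ) p → (∀ j → j ≢ p → f j ≡ 0ℤ) → sumFin m f ≡ f p
sumFin-single (suc m) f zero f≡0 =
  trans (cong (_+_ (f zero)) (sumFin-zero m (f ∘ suc) (λ j → f≡0 (suc j) λ ()))) (+-identityʳ (f zero))
sumFin-single (suc m) f (suc p) f≡0 rewrite f≡0 zero (λ ()) =
  trans (+-identityˡ _) (sumFin-single m (f ∘ suc) p (λ j j≢p → f≡0 (suc j) (j≢p ∘ suc-injective)))

sumFin-pair : ∀ m (f : Fin m → ℤ) p q → p ≢ q → (∀ j → j ≢ p → j ≢ q → f j ≡ 0ℤ) →
              sumFin m f ≡ f p + f q
sumFin-pair (suc m) f zero zero p≢q _ = contradiction refl p≢q
sumFin-pair (suc m) f zero (suc q) _ f≡0 =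
  cong (_+_ (f zero)) (sumFin-single m (f ∘ suc) q (λ j j≢q → f≡0 (suc j) (λ ()) (j≢q ∘ suc-injective)))
sumFin-pair (suc m) f (suc p) zero _ f≡0 =
  trans (cong (_+_ (f zero)) (sumFin-single m (f ∘ suc) p (λ j j≢p → f≡0 (suc j) (j≢p ∘ suc-injective) (λ ()))))
        (+-comm (f zero) (f (suc p)))
sumFin-pair (suc m) f (suc p) (suc q) p≢q f≡0 rewrite f≡0 zero (λ ()) (λ ()) =
  trans (+-identityˡ _)
        (sumFin-pair m (f ∘ suc) p q (p≢q ∘ cong suc)
          (λ j j≢p j≢q → f≡0 (suc j) (j≢p ∘ suc-injective) (j≢q ∘ suc-injective)))

-- Ablock matches on  remQuot = swap ∘ quotRem,  which normalises to quotRem.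
quotRem-combine : ∀ {m} k (i : Fin m) j → quotRem {m} k (combine i j) ≡ (j , i)
quotRem-combine k i j = cong swap (remQuot-combine i j)

Ablock-diagonal : ∀ n (β : Fin n) r c → Ablock n (combine β r) (combine β c) ≡ Amat n r c
Ablock-diagonal n β r c rewrite quotRem-combine (s n) β r | quotRem-combine n β c with β ≟ β
... | yes _   = refl
... | no  β≢β = contradiction refl β≢β

Ablock-offdiagonal : ∀ n {β β′ : Fin n} r c → β ≢ β′ → Ablock n (combine β r) (combine β′ c) ≡ 0ℤ
Ablock-offdiagonal n {β} {β′} r c β≢β′ rewrite quotRem-combine (s n) β r | quotRem-combine n β′ c with β ≟ β′
... | yes β≡β′ = contradiction β≡β′ β≢β′
... | no  _    = refl

cell : ∀ n → Permutation′ (n ℕ.* n) → Fin n → Fin n → Fin (n ℕ.* n)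
cell n π β k = π ⟨$⟩ʳ combine {n} {n} β k

cell-surjective : ∀ n (π : Permutation′ (n ℕ.* n)) j → ∃₂ λ β k → cell n π β k ≡ j
cell-surjective n π j with β , k , β⊗k≡ ← combine-surjective {n} {n} (π ⟨$⟩ˡ j) =
  β , k , trans (cong (π ⟨$⟩ʳ_) β⊗k≡) (inverseʳ π)

cell-injective : ∀ n (π : Permutation′ (n ℕ.* n)) β {k k′} → cell n π β k ≡ cell n π β k′ → k ≡ k′
cell-injective n π β {k} {k′} eq =
  combine-injectiveʳ β k β k′ (trans (sym (inverseˡ π)) (trans (cong (π ⟨$⟩ˡ_) eq) (inverseˡ π)))

Aπ-cell : ∀ n (π : Permutation′ (n ℕ.* n)) (β : Fin n) (r : Fin (s n)) β′ k →
          Aπ n π (combine β r) (cell n π β′ k) ≡ Ablock n (combine β r) (combine β′ k)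
Aπ-cell n π β r β′ k = cong (Ablock n (combine β r)) (inverseˡ π)

edge-row-value : ∀ n (π : Permutation′ (n ℕ.* n)) (y : Fin (n ℕ.* n) → ℤ) β {r a b} → IsEdge n r a b →
                 (Aπ n π · y) (combine β r) ≡ y (cell n π β a) - y (cell n π β b)
edge-row-value n π y β {r} {a} {b} edge@(a↦1 , b↦-1 , rest) =
  trans (sumFin-pair (n ℕ.* n) term p q p≢q term-elsewhere) (cong₂ _+_ term-p term-q)
  where
  p q : Fin (n ℕ.* n)
  p = cell n π β a
  q = cell n π β b
  term : Fin (n ℕ.* n) → ℤ
  term j = Aπ n π (combine β r) j * y j
  p≢q : p ≢ q
  p≢q = edge-distinct edge ∘ cell-injective n π β
  entry : ∀ k → Aπ n π (combine β r) (cell n π β k) ≡ Amat n r k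
  entry k = trans (Aπ-cell n π β r β k) (Ablock-diagonal n β r k)
  term-p : term p ≡ y p
  term-p = trans (cong (_* y p) (trans (entry a) a↦1)) (*-identityˡ (y p))
  term-q : term q ≡ - y q
  term-q = trans (cong (_* y q) (trans (entry b) b↦-1)) (-1*i≡-i (y q))
  entry-elsewhere : ∀ β′ k → cell n π β′ k ≢ p → cell n π β′ k ≢ q → Aπ n π (combine β r) (cell n π β′ k) ≡ 0ℤ
  entry-elsewhere β′ k ≢p ≢q with β ≟ β′
  ... | no  β≢β′ = trans (Aπ-cell n π β r β′ k) (Ablock-offdiagonal n r k β≢β′)
  ... | yes refl = trans (entry k) (rest k (≢p ∘ cong (cell n π β)) (≢q ∘ cong (cell n π β)))
  term-elsewhere : ∀ j → j ≢ p → j ≢ q → term j ≡ 0ℤ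
  term-elsewhere j j≢p j≢q with β′ , k , refl ← cell-surjective n π j =
    trans (cong (_* y j) (entry-elsewhere β′ k j≢p j≢q)) (*-zeroˡ (y j))

blockValues : ∀ n → Permutation′ (n ℕ.* n) → (Fin (n ℕ.* n) → ℤ) → Fin n → Fin n → ℤ
blockValues n π y β k = y (cell n π β k)

Injective : ∀ {A : Set} {n} → (Fin n → A) → Set
Injective g = ∀ {k k′} → g k ≡ g k′ → k ≡ k′

nonzero⇔blocks-injective : ∀ n (π : Permutation′ (n ℕ.* n)) y →
                           AllNonzero (Aπ n π · y) ⇔ (∀ β → Injective (blockValues n π y β))
nonzero⇔blocks-injective n π y = mk⇔ nonzero⇒injective injective⇒nonzero
  where
  nonzero⇒injective : AllNonzero (Aπ n π · y) → ∀ β → Injective (blockValues n π y β)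
  nonzero⇒injective nz β {k} {k′} same with k ≟ k′
  ... | yes k≡k′ = k≡k′
  ... | no  k≢k′ with edge-is-row n k k′ k≢k′
  ...   | r , inj₁ edge = contradiction (trans (edge-row-value n π y β edge) (i≡j⇒i-j≡0 same)) (nz _)
  ...   | r , inj₂ edge = contradiction (trans (edge-row-value n π y β edge) (i≡j⇒i-j≡0 (sym same))) (nz _)
  injective⇒nonzero : (∀ β → Injective (blockValues n π y β)) → AllNonzero (Aπ n π · y)
  injective⇒nonzero inj row row≡0
    with β , r , refl ← combine-surjective {n} {s n} row
    with a , b , edge ← row-is-edge n r =
    edge-distinct edge (inj β (i-j≡0⇒i≡j _ _ (trans (sym (edge-row-value n π y β edge)) row≡0)))

Onto : ∀ {n} → (Fin n → Fin n) → Set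
Onto h = ∀ w → ∃ λ k → h k ≡ w

-- An injective endomap missing a point w would inject Fin (1+m) into Fin m.
injective⇒onto : ∀ {n} (h : Fin n → Fin n) → Injective h → Onto h
injective⇒onto {suc m} h inj w with any? (λ k → h k ≟ w)
... | yes hit  = hit
... | no  miss = contradiction (injective⇒≤ squeeze-injective) ℕ.1+n≰n
  where
  avoids : ∀ k → w ≢ h k
  avoids k w≡hk = miss (k , sym w≡hk)
  squeeze : Fin (suc m) → Fin m
  squeeze k = punchOut (avoids k)
  squeeze-injective : Injective squeeze
  squeeze-injective eq = inj (punchOut-injective (avoids _) (avoids _) eq)

-- A chosen section of an onto endomap is injective, hence onto; so it is also a
-- retraction of the map, which makes the map injective.
onto⇒injective : ∀ {n} (h : Fin n → Fin n) → Onto h → Injective h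
onto⇒injective {n} h onto {k} {k′} hk≡hk′ =
  trans (sym (section-retraction k)) (trans (cong section hk≡hk′) (section-retraction k′))
  where
  section : Fin n → Fin n
  section w = proj₁ (onto w)
  section-inverse : ∀ w → h (section w) ≡ w
  section-inverse w = proj₂ (onto w)
  section-onto : Onto section
  section-onto = injective⇒onto section λ {w} {w′} eq →
    trans (sym (section-inverse w)) (trans (cong h eq) (section-inverse w′))
  section-retraction : ∀ k → section (h k) ≡ k
  section-retraction k with w , refl ← section-onto k = cong section (section-inverse w)

InRange : ℕ → ℤ → Set
InRange n v = + 1 ≤ v × v ≤ + n

Complete : ∀ {m} n → (Fin m → ℤ) → Set
Complete n g = ∀ v → InRange n v → ∃ λ k → g k ≡ v

decode : ∀ {n} → Fin n → ℤ
decode k = + suc (toℕ k)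

decode-injective : ∀ {n} → Injective (decode {n})
decode-injective eq = toℕ-injective (ℕ.suc-injective (+-injective eq))

decode-inRange : ∀ {n} (k : Fin n) → InRange n (decode k)
decode-inRange k = +≤+ (s≤s z≤n) , +≤+ (toℕ<n k)

encode : ∀ {n} v → InRange n v → Fin n
encode (+ zero)  (+≤+ () , _)
encode (+ suc m) (_ , +≤+ m<n) = fromℕ< m<n

decode-encode : ∀ {n} v (v∈ : InRange n v) → decode (encode v v∈) ≡ v
decode-encode (+ zero)  (+≤+ () , _)
decode-encode (+ suc m) (_ , +≤+ m<n) = cong (λ t → + suc t) (toℕ-fromℕ< m<n)

injective⇔complete : ∀ {n} (g : Fin n → ℤ) → (∀ k → InRange n (g k)) → Injective g ⇔ Complete n g
injective⇔complete {n} g g∈ = mk⇔ injective⇒complete complete⇒injective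
  where
  h : Fin n → Fin n
  h k = encode (g k) (g∈ k)
  decode-h : ∀ k → decode (h k) ≡ g k
  decode-h k = decode-encode (g k) (g∈ k)
  h-injective : Injective g → Injective h
  h-injective inj eq = inj (trans (sym (decode-h _)) (trans (cong decode eq) (decode-h _)))
  injective⇒complete : Injective g → Complete n g
  injective⇒complete inj v v∈ = hit (injective⇒onto h (h-injective inj) (encode v v∈))
    where
    hit : (∃ λ k → h k ≡ encode v v∈) → ∃ λ k → g k ≡ v
    hit (k , hk≡) = k , trans (sym (decode-h k)) (trans (cong decode hk≡) (decode-encode v v∈))
  complete⇒injective : Complete n g → Injective g
  complete⇒injective complete eq =
    onto⇒injective h h-onto (decode-injective (trans (decode-h _) (trans eq (sym (decode-h _)))))
    where
    h-onto : Onto h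
    h-onto w with k , gk≡ ← complete (decode w) (decode-inRange w) =
      k , decode-injective (trans (decode-h k) gk≡)

Occurs : ∀ n → Permutation′ (n ℕ.* n) → (Fin (n ℕ.* n) → ℤ) → Fin n → ℤ → Set
Occurs n π y β v = ∃ λ k → blockValues n π y β k ≡ v

inCS⇔occurs : ∀ n (π : Permutation′ (n ℕ.* n)) y β v →
              (∃[ i ] (InCS n π β i × y i ≡ v)) ⇔ Occurs n π y β v
inCS⇔occurs n π y β v = mk⇔ (λ { (_ , (k , refl) , yi≡v) → k , yi≡v })
                            (λ { (k , yk≡v) → cell n π β k , (k , refl) , yk≡v })

consistent⇔same-values : ∀ n (π τ : Permutation′ (n ℕ.* n)) x →
  Consistent n π x τ ⇔ (∀ β v → Occurs n π (permVec τ x) β v ⇔ Occurs n π x β v)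
consistent⇔same-values n π τ x = mk⇔
  (λ cons β v → occurs x β v ⇔-∘ (cons β v ⇔-∘ ⇔-sym (occurs (permVec τ x) β v)))
  (λ same β v → ⇔-sym (occurs x β v) ⇔-∘ (same β v ⇔-∘ occurs (permVec τ x) β v))
  where
  occurs : ∀ y β v → (∃[ i ] (InCS n π β i × y i ≡ v)) ⇔ Occurs n π y β v
  occurs = inCS⇔occurs n π

nonzero⇔complete : ∀ n (π : Permutation′ (n ℕ.* n)) y → (∀ i → InRange n (y i)) →
                   AllNonzero (Aπ n π · y) ⇔ (∀ β → Complete n (blockValues n π y β))
nonzero⇔complete n π y y∈ = mk⇔
  (λ nz β → Equivalence.to (blockwise β) (Equivalence.to (nonzero⇔blocks-injective n π y) nz β))
  (λ complete → Equivalence.from (nonzero⇔blocks-injective n π y)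
                  (λ β → Equivalence.from (blockwise β) (complete β)))
  where
  blockwise : ∀ β → Injective (blockValues n π y β) ⇔ Complete n (blockValues n π y β)
  blockwise β = injective⇔complete (blockValues n π y β) (y∈ ∘ cell n π β)

complete⇒same-values : ∀ n (π : Permutation′ (n ℕ.* n)) y y′ β →
  (∀ i → InRange n (y i)) → (∀ i → InRange n (y′ i)) →
  Complete n (blockValues n π y β) → Complete n (blockValues n π y′ β) → ∀ v → Occurs n π y β v ⇔ Occurs n π y′ β v
complete⇒same-values n π y y′ β y∈ y′∈ complete complete′ v = mk⇔
  (λ { (k , refl) → complete′ _ (y∈ (cell n π β k)) })
  (λ { (k , refl) → complete  _ (y′∈ (cell n π β k)) })

lemma4p3 : (n : ℕ) → n ≥ 1 → (π τ : Permutation′ (n ℕ.* n)) → (x : Fin (n ℕ.* n) → ℤ) → (∀ i → (+ 1 ≤ x i) × (x i ≤ + n))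
    → ((AllNonzero (Aπ n π · x) × AllNonzero (Aπ n π · permVec τ x) → Consistent n π x τ)
    × (AllNonzero (Aπ n π · x) × Consistent n π x τ → AllNonzero (Aπ n π · permVec τ x))
    × (AllNonzero (Aπ n π · permVec τ x) × Consistent n π x τ → AllNonzero (Aπ n π · x)))
lemma4p3 n _ π τ x x∈ = i∧ii⇒iii , i∧iii⇒ii , ii∧iii⇒i
  where
  open Equivalence
  τx : Fin (n ℕ.* n) → ℤ
  τx = permVec τ x
  τx∈ : ∀ i → InRange n (τx i)
  τx∈ i = x∈ (τ ⟨$⟩ˡ i)
  i⇔ : AllNonzero (Aπ n π · x) ⇔ (∀ β → Complete n (blockValues n π x β))
  i⇔ = nonzero⇔complete n π x x∈
  ii⇔ : AllNonzero (Aπ n π · τx) ⇔ (∀ β → Complete n (blockValues n π τx β))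
  ii⇔ = nonzero⇔complete n π τx τx∈
  iii⇔ : Consistent n π x τ ⇔ (∀ β v → Occurs n π τx β v ⇔ Occurs n π x β v)
  iii⇔ = consistent⇔same-values n π τ x

  -- Both value sets are all of {1,…,n}.
  i∧ii⇒iii : AllNonzero (Aπ n π · x) × AllNonzero (Aπ n π · τx) → Consistent n π x τ
  i∧ii⇒iii (nz , nzτ) =
    from iii⇔ λ β → complete⇒same-values n π τx x β τx∈ x∈ (to ii⇔ nzτ β) (to i⇔ nz β)

  -- (iii) transports "every value occurs" from x to τ(x) and back.
  i∧iii⇒ii : AllNonzero (Aπ n π · x) × Consistent n π x τ → AllNonzero (Aπ n π · τx)
  i∧iii⇒ii (nz , cons) =
    from ii⇔ λ β v v∈ → from (to iii⇔ cons β v) (to i⇔ nz β v v∈)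

  ii∧iii⇒i : AllNonzero (Aπ n π · τx) × Consistent n π x τ → AllNonzero (Aπ n π · x)
  ii∧iii⇒i (nzτ , cons) =
    from i⇔ λ β v v∈ → to (to iii⇔ cons β v) (to ii⇔ nzτ β v v∈)
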